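{- Let $p$ be a prime and $n\ge 2$ an integer with $p>n$. For any $x\in\mathbb{Z}_p$ there exist $m\in\{1,\dots,n-1\}$, $k\in\{0,1,\dots,\lceil p/n\rceil-1\}$ and $\sigma\in\{+1,-1\}$ such that $x=\mathfrak{m}_p(\sigma m^{ -1}k)$, where $m^{ -1}$ is the inverse of $m$ modulo $p$.
   Context: $\mathfrak{m}_p(y)$ is the unique element of $(y+p\mathbb{Z})\cap[0,p)$. -}

module Defs where

open import Data.Nat.Base using (ℕ; NonZero; _+_; _∸_; _/_)
open import Data.Integer.Base using (ℤ; _%ℕ_)

𝔪 : (p : ℕ) → .{{NonZero p}} → ℤ → ℕ
𝔪 p y = y %ℕ p

⌈_/_⌉ : ℕ → (b : ℕ) → .{{NonZero b}} → ℕ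
⌈ a / b ⌉ = (a + b ∸ 1) / b

-- Pigeonhole argument in the style of Thue's lemma. Put q = ⌈p/n⌉; since n ∤ p, p < nq. The n + 1
-- numbers p and j·x mod p (0 ≤ j < n) lie in [0, p], so two of them fall into one block
-- [tq, (t+1)q). Counting p as 0·x, their difference k < q is ±m·x mod p, where m < n is the
-- difference of the coefficients; m ≠ 0 because the only pair with equal coefficients, p and 0,
-- is p ≥ q apart. Multiplying σk ≡ m·x by the inverse of m modulo p gives x ≡ σ·m⁻¹·k.

module Submission where

open import Defs

open import Data.Empty using (⊥-elim)
open import Data.Fin.Base as Fin using (Fin; zero; suc; toℕ; fromℕ<)
open import Data.Fin.Properties using (pigeonhole; fromℕ<-injective; toℕ<n)
open import Data.Integer.Base
  using (ℤ; _⊖_; +_; -_; _+_; _-_; _*_; 0ℤ; 1ℤ; -1ℤ; -[1+_]; ∣_∣; _%ℕ_; _/ℕ_)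
open import Data.Integer.DivMod using (a≡a%ℕn+[a/ℕn]*n; n%ℕd<d)
open import Data.Integer.Divisibility.Signed
  using (_∣_; divides; ∣⇒∣ᵤ; ∣m⇒∣-m; ∣m∣n⇒∣m+n; ∣m∣n⇒∣m-n; ∣n⇒∣m*n)
open import Data.Integer.Properties
  using ( [+m]-[+n]≡m⊖n; ∣m⊖n∣≡∣n⊖m∣; ∣⊖∣-≤; ⊖-≥; ∣i∣≡0⇒i≡0; i-j≡0⇒i≡j; +-injective
        ; +-inverseʳ; +-identityʳ; pos-*; -1*i≡-i; *-identityˡ; *-identityʳ; *-comm
        ; neg-distribˡ-*)
open import Data.Integer.Tactic.RingSolver using (solve-∀)
open import Data.Nat.Base as ℕ using (ℕ; NonZero; suc; _≤_; _<_; z≤n; s≤s; z<s)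
open import Data.Nat.Coprimality using (coprime-Bézout; prime⇒coprime)
import Data.Nat.Divisibility as ℕ
open import Data.Nat.DivMod
  using (_%_; _/_; m<n⇒m%n≡m; m≡m%n+[m/n]*n; m%n<n; m<n*o⇒m/o<n; m/n*n≤m)
open import Data.Nat.GCD using (module Bézout)
open import Data.Nat.Primality using (Prime; prime⇒¬composite)
import Data.Nat.Properties as ℕ
open import Data.Product using (∃; ∃₂; _×_; _,_)
open import Data.Sum using (_⊎_; inj₁; inj₂)
open import Level using (0ℓ)
open import Relation.Binary.Bundles using (Setoid)
import Relation.Binary.Reasoning.Setoid as SetoidReasoning
open import Relation.Binary.Structures using (IsEquivalence)
open import Relation.Binary.PropositionalEquality
  using (_≡_; refl; sym; trans; cong; subst; module ≡-Reasoning)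
open import Relation.Nullary.Negation using (¬_)

∣[+m]-[+n]∣≡∣m-n∣ : ∀ m n → ∣ + m - + n ∣ ≡ ℕ.∣ m - n ∣
∣[+m]-[+n]∣≡∣m-n∣ m n with ℕ.≤-total m n
... | inj₁ m≤n = begin
  ∣ + m - + n ∣  ≡⟨ cong ∣_∣ ([+m]-[+n]≡m⊖n m n) ⟩
  ∣ m ⊖ n ∣      ≡⟨ ∣⊖∣-≤ m≤n ⟩
  n ℕ.∸ m        ≡⟨ ℕ.m≤n⇒∣m-n∣≡n∸m m≤n ⟨
  ℕ.∣ m - n ∣    ∎
  where open ≡-Reasoning
... | inj₂ n≤m = begin
  ∣ + m - + n ∣  ≡⟨ cong ∣_∣ ([+m]-[+n]≡m⊖n m n) ⟩
  ∣ m ⊖ n ∣      ≡⟨ ∣m⊖n∣≡∣n⊖m∣ m n ⟩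
  ∣ n ⊖ m ∣      ≡⟨ ∣⊖∣-≤ n≤m ⟩
  m ℕ.∸ n        ≡⟨ ℕ.m≤n⇒∣n-m∣≡n∸m n≤m ⟨
  ℕ.∣ m - n ∣    ∎
  where open ≡-Reasoning

i≡±∣i∣ : ∀ i → ∃ λ σ → (σ ≡ 1ℤ ⊎ σ ≡ -1ℤ) × i ≡ σ * + ∣ i ∣
i≡±∣i∣ (+ n)    = 1ℤ , inj₁ refl , sym (*-identityˡ (+ n))
i≡±∣i∣ -[1+ n ] = -1ℤ , inj₂ refl , sym (-1*i≡-i (+ suc n))

[+m]-[+n]≡±∣m-n∣ : ∀ m n → ∃ λ σ → (σ ≡ 1ℤ ⊎ σ ≡ -1ℤ) × + m - + n ≡ σ * + ℕ.∣ m - n ∣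
[+m]-[+n]≡±∣m-n∣ m n =
  let σ , σ≡±1 , m-n≡σ∣m-n∣ = i≡±∣i∣ (+ m - + n)
  in  σ , σ≡±1 , trans m-n≡σ∣m-n∣ (cong (λ k → σ * + k) (∣[+m]-[+n]∣≡∣m-n∣ m n))

+[1+m*n]≡+[o*q] : ∀ m n o q → 1 ℕ.+ m ℕ.* n ≡ o ℕ.* q → 1ℤ + + m * + n ≡ + o * + q
+[1+m*n]≡+[o*q] m n o q eq = begin
  1ℤ + + m * + n      ≡⟨ cong (_+_ 1ℤ) (pos-* m n) ⟨
  + (1 ℕ.+ m ℕ.* n)   ≡⟨ cong +_ eq ⟩
  + (o ℕ.* q)         ≡⟨ pos-* o q ⟩
  + o * + q           ∎
  where open ≡-Reasoning

+[m*x]-+[n*x]≡+[m∸n]*+x : ∀ {m n} x → n ≤ m → + (m ℕ.* x) - + (n ℕ.* x) ≡ + (m ℕ.∸ n) * + x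
+[m*x]-+[n*x]≡+[m∸n]*+x {m} {n} x n≤m = begin
  + (m ℕ.* x) - + (n ℕ.* x)  ≡⟨ [+m]-[+n]≡m⊖n (m ℕ.* x) (n ℕ.* x) ⟩
  m ℕ.* x ⊖ n ℕ.* x          ≡⟨ ⊖-≥ (ℕ.*-monoˡ-≤ x n≤m) ⟩
  + (m ℕ.* x ℕ.∸ n ℕ.* x)    ≡⟨ cong +_ (ℕ.*-distribʳ-∸ x m n) ⟨
  + ((m ℕ.∸ n) ℕ.* x)        ≡⟨ pos-* (m ℕ.∸ n) x ⟩
  + (m ℕ.∸ n) * + x          ∎
  where open ≡-Reasoning

infix 4 _≡_mod_

-- A record rather than a synonym for + p ∣ a - b, so that a, b and p can be inferred.
record _≡_mod_ (a b : ℤ) (p : ℕ) : Set where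
  constructor congruent
  field divides-difference : + p ∣ a - b

module _ {p : ℕ} where

  ≡-mod-reflexive : ∀ {a b} → a ≡ b → a ≡ b mod p
  ≡-mod-reflexive {a} refl = congruent (divides 0ℤ (+-inverseʳ a))

  ≡-mod-sym : ∀ {a b} → a ≡ b mod p → b ≡ a mod p
  ≡-mod-sym {a} {b} (congruent p∣a-b) =
    congruent (subst (+ p ∣_) (neg-minus a b) (∣m⇒∣-m p∣a-b))
    where
    neg-minus : ∀ a b → - (a - b) ≡ b - a
    neg-minus = solve-∀

  ≡-mod-trans : ∀ {a b c} → a ≡ b mod p → b ≡ c mod p → a ≡ c mod p
  ≡-mod-trans {a} {b} {c} (congruent p∣a-b) (congruent p∣b-c) =
    congruent (subst (+ p ∣_) (minus-telescope a b c) (∣m∣n⇒∣m+n p∣a-b p∣b-c))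
    where
    minus-telescope : ∀ a b c → (a - b) + (b - c) ≡ a - c
    minus-telescope = solve-∀

  ≡-mod-isEquivalence : IsEquivalence (λ a b → a ≡ b mod p)
  ≡-mod-isEquivalence = record
    { refl  = ≡-mod-reflexive refl
    ; sym   = ≡-mod-sym
    ; trans = ≡-mod-trans
    }

  ≡-mod-minus-cong : ∀ {a b c d} → a ≡ b mod p → c ≡ d mod p → a - c ≡ b - d mod p
  ≡-mod-minus-cong {a} {b} {c} {d} (congruent p∣a-b) (congruent p∣c-d) =
    congruent (subst (+ p ∣_) (minus-interchange a b c d) (∣m∣n⇒∣m-n p∣a-b p∣c-d))
    where
    minus-interchange : ∀ a b c d → (a - b) - (c - d) ≡ (a - c) - (b - d)
    minus-interchange = solve-∀

  ≡-mod-*-congˡ : ∀ c {a b} → a ≡ b mod p → c * a ≡ c * b mod p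
  ≡-mod-*-congˡ c {a} {b} (congruent p∣a-b) =
    congruent (subst (+ p ∣_) (*-distribˡ-minus c a b) (∣n⇒∣m*n c p∣a-b))
    where
    *-distribˡ-minus : ∀ c a b → c * (a - b) ≡ c * a - c * b
    *-distribˡ-minus = solve-∀

≡-mod-setoid : ℕ → Setoid 0ℓ 0ℓ
≡-mod-setoid p = record { isEquivalence = ≡-mod-isEquivalence {p} }

module ≡-mod-Reasoning (p : ℕ) = SetoidReasoning (≡-mod-setoid p)

module _ {p : ℕ} .{{_ : NonZero p}} where

  %ℕ-≡-mod : ∀ a → + (a %ℕ p) ≡ a mod p
  %ℕ-≡-mod a = congruent (divides (- (a /ℕ p)) (begin
    + (a %ℕ p) - a                              ≡⟨ cong (_-_ (+ (a %ℕ p))) (a≡a%ℕn+[a/ℕn]*n a p) ⟩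
    + (a %ℕ p) - (+ (a %ℕ p) + (a /ℕ p) * + p)  ≡⟨ minus-cancel (+ (a %ℕ p)) (a /ℕ p) (+ p) ⟩
    - (a /ℕ p) * + p                            ∎))
    where
    open ≡-Reasoning
    minus-cancel : ∀ r t q → r - (r + t * q) ≡ - t * q
    minus-cancel = solve-∀

  residue-unique : ∀ {r s} → r < p → s < p → + r ≡ + s mod p → r ≡ s
  residue-unique {r} {s} r<p s<p (congruent p∣r-s) =
    +-injective (i-j≡0⇒i≡j (+ r) (+ s) (∣i∣≡0⇒i≡0 ∣r-s∣≡0))
    where
    ∣r-s∣<p : ∣ + r - + s ∣ < p
    ∣r-s∣<p = subst (_< p) (sym (∣[+m]-[+n]∣≡∣m-n∣ r s))
                    (ℕ.≤-<-trans (ℕ.∣m-n∣≤m⊔n r s) (ℕ.⊔-pres-<m r<p s<p))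
    ∣r-s∣≡0 : ∣ + r - + s ∣ ≡ 0
    ∣r-s∣≡0 = trans (sym (m<n⇒m%n≡m ∣r-s∣<p)) (ℕ.n∣m⇒m%n≡0 _ p (∣⇒∣ᵤ p∣r-s))

  %ℕ≡residue : ∀ a {r} → r < p → a ≡ + r mod p → a %ℕ p ≡ r
  %ℕ≡residue a r<p a≡r = residue-unique (n%ℕd<d a p) r<p (≡-mod-trans (%ℕ-≡-mod a) a≡r)

≡-mod-cancel-inverse : ∀ {p} m m⁻¹ σ k x →
                       m * m⁻¹ ≡ 1ℤ mod p → σ * k ≡ m * x mod p → σ * m⁻¹ * k ≡ x mod p
≡-mod-cancel-inverse {p} m m⁻¹ σ k x mm⁻¹≡1 σk≡mx = begin
  σ * m⁻¹ * k      ≡⟨ rearrangeˡ σ m⁻¹ k ⟩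
  m⁻¹ * (σ * k)    ≈⟨ ≡-mod-*-congˡ m⁻¹ σk≡mx ⟩
  m⁻¹ * (m * x)    ≡⟨ rearrangeʳ m⁻¹ m x ⟩
  x * (m * m⁻¹)    ≈⟨ ≡-mod-*-congˡ x mm⁻¹≡1 ⟩
  x * 1ℤ           ≡⟨ *-identityʳ x ⟩
  x                ∎
  where
  open ≡-mod-Reasoning p
  rearrangeˡ : ∀ σ m⁻¹ k → σ * m⁻¹ * k ≡ m⁻¹ * (σ * k)
  rearrangeˡ = solve-∀
  rearrangeʳ : ∀ m⁻¹ m x → m⁻¹ * (m * x) ≡ x * (m * m⁻¹)
  rearrangeʳ = solve-∀

prime⇒∃-inverse-mod : ∀ {p m} → Prime p → 1 ≤ m → m < p → ∃ λ m⁻¹ → + m * m⁻¹ ≡ 1ℤ mod p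
prime⇒∃-inverse-mod {p} {m} prime-p 1≤m m<p
  with coprime-Bézout (prime⇒coprime prime-p {{ℕ.>-nonZero 1≤m}} m<p)
... | Bézout.+- x y eq = - + y , congruent (divides (- + x) (begin
  + m * - + y - 1ℤ       ≡⟨ rearrange (+ m) (+ y) ⟩
  - (1ℤ + + y * + m)     ≡⟨ cong -_ (+[1+m*n]≡+[o*q] y m x p eq) ⟩
  - (+ x * + p)          ≡⟨ neg-distribˡ-* (+ x) (+ p) ⟩
  - + x * + p            ∎))
  where
  open ≡-Reasoning
  rearrange : ∀ m y → m * - y - 1ℤ ≡ - (1ℤ + y * m)
  rearrange = solve-∀
... | Bézout.-+ x y eq = + y , congruent (divides (+ x) (begin
  + m * + y - 1ℤ              ≡⟨ cong (_- 1ℤ) (*-comm (+ m) (+ y)) ⟩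
  + y * + m - 1ℤ              ≡⟨ cong (_- 1ℤ) (+[1+m*n]≡+[o*q] x p y m eq) ⟨
  1ℤ + + x * + p - 1ℤ         ≡⟨ cancel (+ x * + p) ⟩
  + x * + p                   ∎))
  where
  open ≡-Reasoning
  cancel : ∀ z → 1ℤ + z - 1ℤ ≡ z
  cancel = solve-∀

m<[1+m/n]*n : ∀ m n .{{_ : NonZero n}} → m < suc (m / n) ℕ.* n
m<[1+m/n]*n m n = begin-strict
  m                      ≡⟨ m≡m%n+[m/n]*n m n ⟩
  m % n ℕ.+ m / n ℕ.* n  <⟨ ℕ.+-monoˡ-< (m / n ℕ.* n) (m%n<n m n) ⟩
  n ℕ.+ m / n ℕ.* n      ∎
  where open ℕ.≤-Reasoning

m≤⌈m/n⌉*n : ∀ m n .{{_ : NonZero n}} → m ≤ ⌈ m / n ⌉ ℕ.* n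
m≤⌈m/n⌉*n m n@(suc n-1) = ℕ.+-cancelˡ-≤ n-1 m (⌈ m / n ⌉ ℕ.* n) (ℕ.s≤s⁻¹ (begin
  suc (n-1 ℕ.+ m)          ≡⟨ cong suc (ℕ.+-comm n-1 m) ⟩
  suc (m ℕ.+ n-1)          ≡⟨ cong suc (ℕ.+-∸-assoc m (s≤s z≤n)) ⟨
  suc (m ℕ.+ n ℕ.∸ 1)      ≤⟨ m<[1+m/n]*n (m ℕ.+ n ℕ.∸ 1) n ⟩
  suc ⌈ m / n ⌉ ℕ.* n      ∎))
  where open ℕ.≤-Reasoning

⌈m/n⌉≤m : ∀ m n .{{_ : NonZero n}} → ⌈ m / n ⌉ ≤ m
⌈m/n⌉≤m m n@(suc n-1) = ℕ.s≤s⁻¹ (m<n*o⇒m/o<n (begin-strict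
  m ℕ.+ n ℕ.∸ 1        ≡⟨ ℕ.+-∸-assoc m (s≤s z≤n) ⟩
  m ℕ.+ n-1            ≡⟨ ℕ.+-comm m n-1 ⟩
  n-1 ℕ.+ m            ≤⟨ ℕ.+-monoʳ-≤ n-1 (ℕ.m≤m*n m n) ⟩
  n-1 ℕ.+ m ℕ.* n      <⟨ ℕ.n<1+n _ ⟩
  suc m ℕ.* n          ∎))
  where open ℕ.≤-Reasoning

m<n*⌈m/n⌉ : ∀ m n .{{_ : NonZero n}} → ¬ n ℕ.∣ m → m < n ℕ.* ⌈ m / n ⌉
m<n*⌈m/n⌉ m n n∤m = subst (m <_) (ℕ.*-comm ⌈ m / n ⌉ n)
  (ℕ.≤∧≢⇒< (m≤⌈m/n⌉*n m n) (λ m≡⌈m/n⌉*n → n∤m (ℕ.divides ⌈ m / n ⌉ m≡⌈m/n⌉*n)))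

prime⇒<n*⌈p/n⌉ : ∀ {p n} .{{_ : NonZero n}} → Prime p → 2 ≤ n → n < p → p < n ℕ.* ⌈ p / n ⌉
prime⇒<n*⌈p/n⌉ {p} {n} prime-p 2≤n n<p = m<n*⌈m/n⌉ p n n∤p
  where
  n∤p : ¬ n ℕ.∣ p
  n∤p n∣p =
    prime⇒¬composite prime-p (ℕ.hasNonTrivialDivisor {{ℕ.n>1⇒nonTrivial 2≤n}} n<p n∣p)

/-≡⇒∸< : ∀ q .{{_ : NonZero q}} {a b} → a / q ≡ b / q → b ℕ.∸ a < q
/-≡⇒∸< q {a} {b} a/q≡b/q = ℕ.m<n+o⇒m∸n<o b a (begin-strict
  b                     <⟨ m<[1+m/n]*n b q ⟩
  q ℕ.+ b / q ℕ.* q     ≡⟨ cong (λ t → q ℕ.+ t ℕ.* q) a/q≡b/q ⟨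
  q ℕ.+ a / q ℕ.* q     ≤⟨ ℕ.+-monoʳ-≤ q (m/n*n≤m a q) ⟩
  q ℕ.+ a               ≡⟨ ℕ.+-comm q a ⟩
  a ℕ.+ q               ∎)
  where open ℕ.≤-Reasoning

/-≡⇒∣-∣< : ∀ q .{{_ : NonZero q}} {a b} → a / q ≡ b / q → ℕ.∣ a - b ∣ < q
/-≡⇒∣-∣< q {a} {b} a/q≡b/q with ℕ.≤-total a b
... | inj₁ a≤b = subst (_< q) (sym (ℕ.m≤n⇒∣m-n∣≡n∸m a≤b)) (/-≡⇒∸< q a/q≡b/q)
... | inj₂ b≤a = subst (_< q) (sym (ℕ.m≤n⇒∣n-m∣≡n∸m b≤a)) (/-≡⇒∸< q (sym a/q≡b/q))

pigeonhole-∣-∣< : ∀ {n} q .{{_ : NonZero q}} (v : Fin (suc n) → ℕ) → (∀ i → v i < n ℕ.* q) →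
                  ∃₂ λ i j → i Fin.< j × ℕ.∣ v i - v j ∣ < q
pigeonhole-∣-∣< {n} q v v<nq =
  let i , j , i<j , same-bucket = pigeonhole (ℕ.n<1+n n) bucket
  in  i , j , i<j , /-≡⇒∣-∣< q (fromℕ<-injective _ _ (bucket< i) (bucket< j) same-bucket)
  where
  bucket< : ∀ i → v i / q < n
  bucket< i = m<n*o⇒m/o<n (v<nq i)
  bucket : Fin (suc n) → Fin n
  bucket i = fromℕ< (bucket< i)

module _ (p n q x : ℕ) .{{_ : NonZero p}} (p<nq : p < n ℕ.* q) where

  private
    instance
      q≢0 : NonZero q
      q≢0 = ℕ.m*n≢0⇒n≢0 n {{ℕ.>-nonZero (ℕ.≤-<-trans z≤n p<nq)}}

    point : Fin (suc n) → ℕ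
    point zero    = p
    point (suc j) = toℕ j ℕ.* x % p

    coefficient : Fin (suc n) → ℕ
    coefficient zero    = 0
    coefficient (suc j) = toℕ j

    point≤p : ∀ i → point i ≤ p
    point≤p zero    = ℕ.≤-refl
    point≤p (suc j) = ℕ.<⇒≤ (m%n<n (toℕ j ℕ.* x) p)

    point≡coefficient*x : ∀ i → + point i ≡ + (coefficient i ℕ.* x) mod p
    point≡coefficient*x zero    =
      congruent (divides 1ℤ (trans (+-identityʳ (+ p)) (sym (*-identityˡ (+ p)))))
    point≡coefficient*x (suc j) = %ℕ-≡-mod (+ (toℕ j ℕ.* x))

  SmallMultiple : Set
  SmallMultiple = ∃ λ m → 1 ≤ m × m < n × ∃ λ k → k < q ×
                    ∃ λ σ → (σ ≡ 1ℤ ⊎ σ ≡ -1ℤ) × σ * + k ≡ + m * + x mod p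

  private
    close-points⇒small-multiple : ∀ i j → coefficient i < coefficient j → coefficient j < n →
                                  ℕ.∣ point i - point j ∣ < q → SmallMultiple
    close-points⇒small-multiple i j cᵢ<cⱼ cⱼ<n close =
      let σ , σ≡±1 , difference≡σk = [+m]-[+n]≡±∣m-n∣ (point j) (point i) in
      m , ℕ.m<n⇒0<n∸m cᵢ<cⱼ , ℕ.≤-<-trans (ℕ.m∸n≤m cⱼ cᵢ) cⱼ<n ,
      ℕ.∣ point j - point i ∣ , subst (_< q) (ℕ.∣-∣-comm (point i) (point j)) close ,
      σ , σ≡±1 , (begin
        σ * + ℕ.∣ point j - point i ∣  ≡⟨ difference≡σk ⟨
        + point j - + point i          ≈⟨ ≡-mod-minus-cong (point≡coefficient*x j)
                                                           (point≡coefficient*x i) ⟩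
        + (cⱼ ℕ.* x) - + (cᵢ ℕ.* x)    ≡⟨ +[m*x]-+[n*x]≡+[m∸n]*+x x (ℕ.<⇒≤ cᵢ<cⱼ) ⟩
        + m * + x                      ∎)
      where
      open ≡-mod-Reasoning p
      cᵢ = coefficient i
      cⱼ = coefficient j
      m = cⱼ ℕ.∸ cᵢ

  small-multiple : q ≤ p → SmallMultiple
  small-multiple q≤p with pigeonhole-∣-∣< q point (λ i → ℕ.≤-<-trans (point≤p i) p<nq)
  ... | zero , suc zero , _ , close = ⊥-elim (ℕ.<⇒≱ p<q q≤p)
    where
    -- p and 0 are the two points with coefficient 0, but they lie p ≥ q apart.
    p<q : p < q
    p<q = subst (_< q) (trans (cong (λ r → ℕ.∣ p - r ∣) (m<n⇒m%n≡m (ℕ.>-nonZero⁻¹ p)))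
                              (ℕ.∣-∣-identityʳ p)) close
  ... | zero , suc (suc j) , _ , close =
    close-points⇒small-multiple zero (suc (suc j)) z<s (toℕ<n (suc j)) close
  ... | suc i , suc j , i<j , close =
    close-points⇒small-multiple (suc i) (suc j) (ℕ.s<s⁻¹ i<j) (toℕ<n j) close

mainTheorem18 : (p n : ℕ) → .{{_ : NonZero p}} → .{{_ : NonZero n}} →
    Prime p → 2 ≤ n → n < p →
    (x : ℕ) → x < p →
    ∃ λ (m : ℕ) → 1 ≤ m × m < n ×
      ∃ λ (k : ℕ) → k < ⌈ p / n ⌉ ×
        ∃ λ (σ : ℤ) → (σ ≡ 1ℤ ⊎ σ ≡ -1ℤ) ×
          -- m⁻¹ : an inverse of m modulo p (the result does not depend on the choice)
          ∃ λ (mInv : ℤ) → 𝔪 p (+ m * mInv) ≡ 1 ×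
            x ≡ 𝔪 p (σ * mInv * + k)
mainTheorem18 p n prime-p 2≤n n<p x x<p
  with m , 1≤m , m<n , k , k<q , σ , σ≡±1 , σk≡mx ←
         small-multiple p n ⌈ p / n ⌉ x
           (prime⇒<n*⌈p/n⌉ prime-p 2≤n n<p) (⌈m/n⌉≤m p n)
  with m⁻¹ , mm⁻¹≡1 ← prime⇒∃-inverse-mod prime-p 1≤m (ℕ.<-trans m<n n<p)
  = m , 1≤m , m<n , k , k<q , σ , σ≡±1 , m⁻¹ ,
    %ℕ≡residue (+ m * m⁻¹) (ℕ.≤-trans 2≤n (ℕ.<⇒≤ n<p)) mm⁻¹≡1 ,
    sym (%ℕ≡residue (σ * m⁻¹ * + k) x<p
           (≡-mod-cancel-inverse (+ m) m⁻¹ σ (+ k) (+ x) mm⁻¹≡1 σk≡mx))
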